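{- For every integer $n\ge 3$, $\mathrm{tri}_n\le 2n-2\lfloor\log_2(n+1)\rfloor+1$.
   Context: A $k$-ranking of a graph $G$ is a labeling $f:V(G)\to\{1,\dots,k\}$ such that every path between two distinct vertices with the same label contains a vertex with a larger label; $\chi_r(G)$ is the least such $k$. The triangle grid graph $T_n$ is the induced subgraph of the infinite grid on $\mathbb{Z}^2$ (vertices adjacent iff they agree in one coordinate and differ by $1$ in the other) on $\{(i,j): i,j\ge 1,\ i+j\le n+1\}$ (rows of $1,2,\dots,n$ vertices forming a staircase), and $\mathrm{tri}_n=\chi_r(T_n)$. -}

module Defs where

open import Data.Nat using (ℕ; zero; suc; _+_; _*_; _∸_; _≤_; _<_)
open import Data.Nat.Logarithm using (⌊log₂_⌋)
open import Data.Product using (_×_; _,_; Σ; ∃; proj₁; proj₂)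
open import Data.Sum using (_⊎_)
open import Data.Unit using (⊤)
open import Data.List using (List; []; _∷_)
open import Data.List.Relation.Unary.All using (All)
open import Data.List.Relation.Unary.Any using (Any)
open import Data.List.Relation.Unary.Unique.Propositional using (Unique)
open import Relation.Binary.PropositionalEquality using (_≡_)
open import Relation.Nullary using (¬_)

-- Points of ℤ² restricted to the positive quadrant (all vertices of T_n lie there).
Point : Set
Point = ℕ × ℕ

InT : ℕ → Point → Set
InT n (i , j) = (1 ≤ i) × (1 ≤ j) × (i + j ≤ n + 1)

Diff1 : ℕ → ℕ → Set
Diff1 a b = (suc a ≡ b) ⊎ (suc b ≡ a)

Adj : Point → Point → Set
Adj (i , j) (i' , j') = ((i ≡ i') × Diff1 j j') ⊎ ((j ≡ j') × Diff1 i i')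

Chain : List Point → Set
Chain [] = ⊤
Chain (x ∷ []) = ⊤
Chain (x ∷ y ∷ ys) = Adj x y × Chain (y ∷ ys)

-- A path in T_n from u to v, given as the list of its interior vertices:
-- the vertex sequence u ∷ interior ++ [ v ] is a chain of adjacent vertices,
-- all vertices lie in T_n, and all vertices are distinct (a simple path).
open import Data.List using (_++_; [_])

PathIn : ℕ → Point → List Point → Point → Set
PathIn n u int v =
  Chain (u ∷ int ++ [ v ]) × All (InT n) (u ∷ int ++ [ v ]) × Unique (u ∷ int ++ [ v ])

IsRanking : ℕ → ℕ → (Point → ℕ) → Set
IsRanking n k f =
  (∀ p → InT n p → 1 ≤ f p × f p ≤ k) ×
  (∀ u v int → ¬ (u ≡ v) → f u ≡ f v → PathIn n u int v →
     Any (λ w → f u < f w) (u ∷ int ++ [ v ]))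

TriLe : ℕ → ℕ → Set
TriLe n k = Σ (Point → ℕ) (IsRanking n k)

-- A labelling ranks a vertex set as soon as some separator S carries pairwise distinct
-- labels above all others and the rest is ranked; pieces that are not adjacent can be
-- ranked independently, and rankings pull back along grid embeddings.
--
-- Let t be the bound for T_k with k = ⌊(N - 1)/2⌋ and m = ⌊N/2⌋.  For N = 2m the
-- diagonal i = j takes the top labels t + m + i; the upper half minus the row j = m + 1
-- is a reflected and a translated copy of T_k, so that row takes t + 1, …, t + m, and the
-- lower half is the transpose of the upper one.  For N = 2m + 1 the line j = i + 1 takes
-- the top labels; above it the row j = m + 2 and below it the column i = m + 1 cut off
-- two copies of T_k each.  Hence tri_N ≤ tri_k + 2m, and 2N - 2⌊log₂(N+1)⌋ + 1 satisfies
-- this recurrence with equality because ⌊log₂(N+1)⌋ = 1 + ⌊log₂(k+1)⌋.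
module Submission where

open import Defs
open import Data.Nat using (ℕ; _+_; _*_; _∸_; _≤_)
open import Data.Nat.Logarithm using (⌊log₂_⌋)

open import Level using (0ℓ)
open import Function using (_∘_; id)
open import Data.Nat using (zero; suc; _<_; z≤n; s≤s; ⌊_/2⌋; >-nonZero)
open import Data.Nat.Properties
open import Data.Nat.Induction using (<-rec)
open import Data.Nat.Logarithm
  using (⌊log₂⌋-mono-≤; ⌊log₂⌊n/2⌋⌋≡⌊log₂n⌋∸1; ⌊log₂[2*b]⌋≡1+⌊log₂b⌋)
open import Data.Nat.Tactic.RingSolver using (solve-∀)
open import Data.Product using (_×_; _,_; proj₁; proj₂; swap; ∃-syntax)
open import Data.Product.Properties using (,-injective; ×-≡,≡→≡)
import Data.Product as Product
open import Data.Sum using (_⊎_; inj₁; inj₂)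
import Data.Sum as Sum
open import Data.Empty using (⊥; ⊥-elim)
open import Data.List using ([]; _∷_; _++_; [_]; map)
open import Data.List.Properties using (map-++)
open import Data.List.Relation.Unary.All as All using (All; []; _∷_)
import Data.List.Relation.Unary.All.Properties as All
open import Data.List.Relation.Unary.Any as Any using (Any; here; there)
import Data.List.Relation.Unary.Any.Properties as Any
open import Relation.Binary.PropositionalEquality hiding ([_])
open import Relation.Binary.Definitions using (tri<; tri≈; tri>)
open import Relation.Nullary using (¬_)
open import Relation.Unary using (Pred; _⊆_; _∪_; _∩_; U; ｛_｝)

-- Unlike IsRanking this quantifies over all walks, not only simple paths.
HigherOnWalks : Pred Point 0ℓ → (Point → ℕ) → Set
HigherOnWalks P f = ∀ u v int → u ≢ v → f u ≡ f v → Chain (u ∷ int ++ [ v ]) →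
  All P (u ∷ int ++ [ v ]) → Any (λ w → f u < f w) (u ∷ int ++ [ v ])

record Ranking (P : Pred Point 0ℓ) (k : ℕ) (f : Point → ℕ) : Set where
  field
    positive : ∀ {p} → P p → 1 ≤ f p
    bounded : ∀ {p} → P p → f p ≤ k
    higher-on-walks : HigherOnWalks P f

open Ranking

All-last : ∀ {P : Pred Point 0ℓ} u int v → All P (u ∷ int ++ [ v ]) → P v
All-last u int v ps = All.head (All.++⁻ʳ (u ∷ int) ps)

any-or-all : ∀ {A : Set} {S P : Pred A 0ℓ} {xs} → All (S ∪ P) xs → Any S xs ⊎ All P xs
any-or-all [] = inj₂ []
any-or-all (inj₁ s ∷ _) = inj₁ (here s)
any-or-all (inj₂ p ∷ ps) = Sum.map there (p ∷_) (any-or-all ps)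

any-with-all : ∀ {A : Set} {P Q R : Pred A 0ℓ} → (∀ {x} → P x → Q x → R x) →
  ∀ {xs} → All P xs → Any Q xs → Any R xs
any-with-all f (p ∷ _) (here q) = here (f p q)
any-with-all f (_ ∷ ps) (there q) = there (any-with-all f ps q)

ranking-empty : ∀ {P k f} → (∀ {p} → ¬ P p) → Ranking P k f
ranking-empty empty = record
  { positive = ⊥-elim ∘ empty
  ; bounded = ⊥-elim ∘ empty
  ; higher-on-walks = λ _ _ _ _ _ _ ps → ⊥-elim (empty (All.head ps))
  }

ranking-singleton : ∀ {p k f} → 1 ≤ f p → f p ≤ k → Ranking ｛ p ｝ k f
ranking-singleton 1≤fp fp≤k = record
  { positive = λ { refl → 1≤fp }
  ; bounded = λ { refl → fp≤k }
  ; higher-on-walks = λ u v int u≢v _ _ ps →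
      ⊥-elim (u≢v (trans (sym (All.head ps)) (All-last u int v ps)))
  }

record FreshLabels (S : Pred Point 0ℓ) (τ w : ℕ) (f : Point → ℕ) : Set where
  field
    index : Point → ℕ
    label≡ : ∀ {p} → S p → f p ≡ τ + index p
    index-positive : ∀ {p} → S p → 1 ≤ index p
    index-bounded : ∀ {p} → S p → index p ≤ w
    index-injective : ∀ {p q} → S p → S q → index p ≡ index q → p ≡ q

ranking-separator : ∀ {Q S P f τ w} → Q ⊆ S ∪ P → FreshLabels S τ w f → Ranking P τ f →
  Ranking Q (τ + w) f
ranking-separator {Q} {S} {P} {f} {τ} {w} cover fresh rP = record
  { positive = λ q → Sum.[ ≤-<-trans z≤n ∘ above , positive rP ] (cover q)
  ; bounded = λ q → Sum.[ on-S , (λ p → ≤-trans (bounded rP p) (m≤m+n τ w)) ] (cover q)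
  ; higher-on-walks = walks
  }
  where
  open FreshLabels fresh
  above : ∀ {p} → S p → τ < f p
  above s = subst (τ <_) (sym (label≡ s)) (m<m+n τ (index-positive s))
  on-S : ∀ {p} → S p → f p ≤ τ + w
  on-S s = subst (_≤ τ + w) (sym (label≡ s)) (+-monoʳ-≤ τ (index-bounded s))
  injective : ∀ {p q} → S p → S q → f p ≡ f q → p ≡ q
  injective s s' e = index-injective s s'
    (+-cancelˡ-≡ τ _ _ (trans (sym (label≡ s)) (trans e (label≡ s'))))
  walks : HigherOnWalks Q f
  walks u v int u≢v fu≡fv chain inQ with any-or-all (All.map cover inQ)
  ... | inj₂ inP = higher-on-walks rP u v int u≢v fu≡fv chain inP
  ... | inj₁ meetsS with cover (All.head inQ) | cover (All-last u int v inQ)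
  ...   | inj₁ su | inj₁ sv = ⊥-elim (u≢v (injective su sv fu≡fv))
  ...   | inj₁ su | inj₂ pv = ⊥-elim (<⇒≱ (above su) (subst (_≤ τ) (sym fu≡fv) (bounded rP pv)))
  ...   | inj₂ pu | _ = Any.map (≤-<-trans (bounded rP pu) ∘ above) meetsS

NonAdjacent : Pred Point 0ℓ → Pred Point 0ℓ → Set
NonAdjacent P R = ∀ {p q} → P p → R q → ¬ Adj p q

adj-sym : ∀ {p q} → Adj p q → Adj q p
adj-sym = Sum.map (Product.map sym Sum.swap) (Product.map sym Sum.swap)

nonAdjacent-sym : ∀ {P R} → NonAdjacent P R → NonAdjacent R P
nonAdjacent-sym apart r p = apart p r ∘ adj-sym

walk-stays : ∀ {P R} → NonAdjacent P R → ∀ {x xs} → Chain (x ∷ xs) → P x →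
  All (P ∪ R) xs → All P (x ∷ xs)
walk-stays apart {xs = []} _ px [] = px ∷ []
walk-stays apart {xs = _ ∷ _} (_ , chain) px (inj₁ py ∷ rest) = px ∷ walk-stays apart chain py rest
walk-stays apart {xs = _ ∷ _} (adj , _) px (inj₂ ry ∷ _) = ⊥-elim (apart px ry adj)

ranking-∪ : ∀ {P R k f} → NonAdjacent P R → Ranking P k f → Ranking R k f →
  Ranking (P ∪ R) k f
ranking-∪ {P} {R} {k} {f} apart rP rR = record
  { positive = Sum.[ positive rP , positive rR ]
  ; bounded = Sum.[ bounded rP , bounded rR ]
  ; higher-on-walks = walks
  }
  where
  walks : HigherOnWalks (P ∪ R) f
  walks u v int u≢v fu≡fv chain (inj₁ pu ∷ rest) =
    higher-on-walks rP u v int u≢v fu≡fv chain (walk-stays apart chain pu rest)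
  walks u v int u≢v fu≡fv chain (inj₂ ru ∷ rest) =
    higher-on-walks rR u v int u≢v fu≡fv chain
      (walk-stays (nonAdjacent-sym apart) chain ru (All.map Sum.swap rest))

record EmbeddingOn {A B : Set} (_~_ : A → A → Set) (_≈_ : B → B → Set)
                   (D : Pred A 0ℓ) (φ : A → B) : Set where
  field
    preserves : ∀ {x y} → D x → D y → x ~ y → φ x ≈ φ y
    injective : ∀ {x y} → D x → D y → φ x ≡ φ y → x ≡ y

open EmbeddingOn

restrict : ∀ {A B : Set} {_~_ _≈_} {D D' : Pred A 0ℓ} {φ : A → B} →
  D' ⊆ D → EmbeddingOn _~_ _≈_ D φ → EmbeddingOn _~_ _≈_ D' φ
restrict D'⊆D e = record
  { preserves = λ x y → preserves e (D'⊆D x) (D'⊆D y)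
  ; injective = λ x y → injective e (D'⊆D x) (D'⊆D y)
  }

reflect-embedding : ∀ c → EmbeddingOn Diff1 Diff1 (_≤ c) (c ∸_)
reflect-embedding c = record
  { preserves = λ { x≤c y≤c (inj₁ refl) → inj₂ (sym (+-∸-assoc 1 y≤c))
                  ; x≤c y≤c (inj₂ refl) → inj₁ (sym (+-∸-assoc 1 x≤c)) }
  ; injective = ∸-cancelˡ-≡
  }

shift-embedding : ∀ c → EmbeddingOn Diff1 Diff1 (c ≤_) (_∸ c)
shift-embedding c = record
  { preserves = λ { c≤x c≤y (inj₁ refl) → inj₁ (sym (+-∸-assoc 1 c≤x))
                  ; c≤x c≤y (inj₂ refl) → inj₂ (sym (+-∸-assoc 1 c≤y)) }
  ; injective = λ c≤x c≤y e → trans (sym (m∸n+n≡m c≤x)) (trans (cong (_+ c) e) (m∸n+n≡m c≤y))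
  }

map₂-embedding : ∀ {D σ} → EmbeddingOn Diff1 Diff1 D σ →
  EmbeddingOn Adj Adj (D ∘ proj₂) (Product.map₂ σ)
map₂-embedding e = record
  { preserves = λ { dy dy' (inj₁ (i≡i' , d)) → inj₁ (i≡i' , preserves e dy dy' d)
                  ; dy dy' (inj₂ (j≡j' , d)) → inj₂ (cong _ j≡j' , d) }
  ; injective = λ dy dy' eq → let i≡i' , σj≡σj' = ,-injective eq in
      ×-≡,≡→≡ (i≡i' , injective e dy dy' σj≡σj')
  }

swap-embedding : EmbeddingOn Adj Adj U swap
swap-embedding = record
  { preserves = λ _ _ → Sum.swap
  ; injective = λ _ _ → cong swap
  }

chain-map : ∀ {P : Pred Point 0ℓ} {φ} → EmbeddingOn Adj Adj P φ →
  ∀ {xs} → All P xs → Chain xs → Chain (map φ xs)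
chain-map e {[]} _ _ = _
chain-map e {_ ∷ []} _ _ = _
chain-map e {_ ∷ _ ∷ _} (px ∷ py ∷ ps) (adj , chain) =
  preserves e px py adj , chain-map e (py ∷ ps) chain

ranking-pullback : ∀ {P Q k f f'} (φ : Point → Point) → EmbeddingOn Adj Adj P φ →
  (∀ {p} → P p → Q (φ p)) → (∀ {p} → P p → f' p ≡ f (φ p)) →
  Ranking Q k f → Ranking P k f'
ranking-pullback {P} {Q} {k} {f} {f'} φ e into agree rQ = record
  { positive = λ p → subst (1 ≤_) (sym (agree p)) (positive rQ (into p))
  ; bounded = λ p → subst (_≤ k) (sym (agree p)) (bounded rQ (into p))
  ; higher-on-walks = walks
  }
  where
  walks : HigherOnWalks P f'
  walks u v int u≢v fu≡fv chain inP =
    any-with-all back inP (Any.map⁻ (subst (Any _) (sym image) forward))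
    where
    pu : P u
    pu = All.head inP
    pv : P v
    pv = All-last u int v inP
    image : map φ (u ∷ int ++ [ v ]) ≡ φ u ∷ map φ int ++ [ φ v ]
    image = cong (φ u ∷_) (map-++ φ int [ v ])
    forward : Any (λ w → f (φ u) < f w) (φ u ∷ map φ int ++ [ φ v ])
    forward = higher-on-walks rQ (φ u) (φ v) (map φ int)
      (u≢v ∘ injective e pu pv)
      (trans (sym (agree pu)) (trans fu≡fv (agree pv)))
      (subst Chain image (chain-map e inP chain))
      (subst (All Q) image (All.map⁺ (All.map into inP)))
    back : ∀ {w} → P w → f (φ u) < f (φ w) → f' u < f' w
    back pw = subst₂ _<_ (sym (agree pu)) (sym (agree pw))

ranking-cong : ∀ {P k f f'} → (∀ {p} → P p → f' p ≡ f p) → Ranking P k f → Ranking P k f'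
ranking-cong agree = ranking-pullback id
  (record { preserves = λ _ _ → id ; injective = λ _ _ → id }) id agree

case-cmp : ∀ {A : Set} → ℕ → ℕ → A → A → A → A
case-cmp x y lt eq gt with <-cmp x y
... | tri< _ _ _ = lt
... | tri≈ _ _ _ = eq
... | tri> _ _ _ = gt

module _ {A : Set} {x y : ℕ} {lt eq gt : A} where

  case-cmp-< : x < y → case-cmp x y lt eq gt ≡ lt
  case-cmp-< x<y with <-cmp x y
  ... | tri< _ _ _ = refl
  ... | tri≈ _ x≡y _ = ⊥-elim (<-irrefl x≡y x<y)
  ... | tri> _ _ y<x = ⊥-elim (<-asym x<y y<x)

  case-cmp-≡ : x ≡ y → case-cmp x y lt eq gt ≡ eq
  case-cmp-≡ x≡y with <-cmp x y
  ... | tri< x<y _ _ = ⊥-elim (<-irrefl x≡y x<y)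
  ... | tri≈ _ _ _ = refl
  ... | tri> _ _ y<x = ⊥-elim (<-irrefl (sym x≡y) y<x)

  case-cmp-> : y < x → case-cmp x y lt eq gt ≡ gt
  case-cmp-> y<x with <-cmp x y
  ... | tri< x<y _ _ = ⊥-elim (<-asym x<y y<x)
  ... | tri≈ _ x≡y _ = ⊥-elim (<-irrefl (sym x≡y) y<x)
  ... | tri> _ _ _ = refl

trichotomy-cover : ∀ {Q : Pred Point 0ℓ} (h k : Point → ℕ) →
  Q ⊆ (Q ∩ λ p → h p ≡ k p) ∪ ((Q ∩ λ p → h p < k p) ∪ (Q ∩ λ p → k p < h p))
trichotomy-cover h k {p} q with <-cmp (h p) (k p)
... | tri< lt _ _ = inj₂ (inj₁ (q , lt))
... | tri≈ _ eq _ = inj₁ (q , eq)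
... | tri> _ _ gt = inj₂ (inj₂ (q , gt))

diff1-not-across : ∀ {x y c} → Diff1 x y → x < c → c < y → ⊥
diff1-not-across (inj₁ refl) x<c c<y = <-irrefl refl (<-≤-trans x<c (≤-pred c<y))
diff1-not-across (inj₂ refl) x<c c<y = <-asym (<-trans c<y (n<1+n _)) x<c

diff1-+ : ∀ s {x y} → Diff1 x y → Diff1 (s + x) (s + y)
diff1-+ s {x} {y} = Sum.map (λ e → trans (sym (+-suc s x)) (cong (s +_) e))
                            (λ e → trans (sym (+-suc s y)) (cong (s +_) e))

row-separates : ∀ c → NonAdjacent (λ p → proj₂ p < c) (λ p → c < proj₂ p)
row-separates c j<c c<j' (inj₁ (_ , d)) = diff1-not-across d j<c c<j'
row-separates c j<c c<j' (inj₂ (refl , _)) = <-asym j<c c<j'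

diagonal-separates : ∀ s →
  NonAdjacent (λ p → proj₂ p < s + proj₁ p) (λ p → s + proj₁ p < proj₂ p)
diagonal-separates s below above (inj₁ (refl , d)) = diff1-not-across d below above
diagonal-separates s below above (inj₂ (refl , d)) =
  diff1-not-across (Sum.swap (diff1-+ s d)) above below

adj-shares-coordinate : ∀ {p q} → Adj p q → proj₁ p ≡ proj₁ q ⊎ proj₂ p ≡ proj₂ q
adj-shares-coordinate = Sum.map proj₁ proj₁

InT-swap : ∀ {n i j} → InT n (i , j) → InT n (j , i)
InT-swap {n} {i} {j} (1≤i , 1≤j , i+j≤) = 1≤j , 1≤i , subst (_≤ n + 1) (+-comm i j) i+j≤

InT-zero-empty : ∀ {p} → ¬ InT 0 p
InT-zero-empty {suc i , suc j} (_ , _ , s≤s i+1+j≤0) with m+n≤o⇒n≤o i i+1+j≤0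
... | ()

reflected-sum : ∀ {i j c} → i < j → j ≤ c → i + (c ∸ j) < c
reflected-sum {i} {j} {c} i<j j≤c =
  subst (i + (c ∸ j) <_) (m+[n∸m]≡n j≤c) (+-monoˡ-< (c ∸ j) i<j)

shifted-sum : ∀ {i j c b} → c ≤ j → i + j ≤ c + b → i + (j ∸ c) ≤ b
shifted-sum {i} {j} {c} {b} c≤j i+j≤ = begin
  i + (j ∸ c)  ≡⟨ sym (+-∸-assoc i c≤j) ⟩
  i + j ∸ c    ≤⟨ ∸-monoˡ-≤ c i+j≤ ⟩
  c + b ∸ c    ≡⟨ m+n∸m≡n c b ⟩
  b            ∎
  where open ≤-Reasoning

⌊1+n+n/2⌋≡n : ∀ n → ⌊ suc (n + n) /2⌋ ≡ n
⌊1+n+n/2⌋≡n zero = refl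
⌊1+n+n/2⌋≡n (suc n) = cong suc (trans (cong ⌊_/2⌋ (+-suc n n)) (⌊1+n+n/2⌋≡n n))

half-≤ : ∀ {i m} → i + i ≤ suc (m + m) → i ≤ m
half-≤ {i} {m} i+i≤ = subst₂ _≤_ (sym (n≡⌊n+n/2⌋ i)) (⌊1+n+n/2⌋≡n m) (⌊n/2⌋-mono i+i≤)

glue-at-row : ℕ → (Point → ℕ) → (ℕ → ℕ) → Point → ℕ
glue-at-row c f ℓ (i , j) = case-cmp j c (f (i , c ∸ j)) (ℓ i) (f (i , j ∸ c))

module _ {a t c : ℕ} {f : Point → ℕ} {H : Pred Point 0ℓ} (f-ranks : Ranking (InT a) t f)
         (below-into : ∀ {i j} → H (i , j) → j < c → InT a (i , c ∸ j))
         (above-into : ∀ {i j} → H (i , j) → c < j → InT a (i , j ∸ c)) where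

  ranking-off-row : ∀ ℓ →
    Ranking ((H ∩ λ p → proj₂ p < c) ∪ (H ∩ λ p → c < proj₂ p)) t (glue-at-row c f ℓ)
  ranking-off-row ℓ = ranking-∪ (λ (_ , j<c) (_ , c<j) → row-separates c j<c c<j)
    (ranking-pullback (Product.map₂ (c ∸_))
      (restrict (<⇒≤ ∘ proj₂) (map₂-embedding (reflect-embedding c)))
      (λ (h , j<c) → below-into h j<c) (λ (_ , j<c) → case-cmp-< j<c) f-ranks)
    (ranking-pullback (Product.map₂ (_∸ c))
      (restrict (<⇒≤ ∘ proj₂) (map₂-embedding (shift-embedding c)))
      (λ (h , c<j) → above-into h c<j) (λ (_ , c<j) → case-cmp-> c<j) f-ranks)

  ranking-cut-at-row : ∀ {w} → (∀ {i} → H (i , c) → 1 ≤ i × i ≤ w) →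
    Ranking H (t + w) (glue-at-row c f (t +_))
  ranking-cut-at-row {w} on-row =
    ranking-separator (trichotomy-cover {H} proj₂ (λ _ → c)) row-labels (ranking-off-row (t +_))
    where
    on-row′ : ∀ {p} → (H ∩ λ p → proj₂ p ≡ c) p → 1 ≤ proj₁ p × proj₁ p ≤ w
    on-row′ {i , _} (h , refl) = on-row h
    row-labels : FreshLabels (H ∩ λ p → proj₂ p ≡ c) t w (glue-at-row c f (t +_))
    row-labels = record
      { index = proj₁
      ; label≡ = λ (_ , j≡c) → case-cmp-≡ j≡c
      ; index-positive = proj₁ ∘ on-row′
      ; index-bounded = proj₂ ∘ on-row′
      ; index-injective = λ (_ , j≡c) (_ , j'≡c) i≡i' → ×-≡,≡→≡ (i≡i' , trans j≡c (sym j'≡c))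
      }

module EvenStep {a t : ℕ} {f : Point → ℕ} (f-ranks : Ranking (InT a) t f) where

  m c : ℕ
  m = suc a
  c = suc m

  upper : Point → ℕ
  upper = glue-at-row c f (t +_)

  label : Point → ℕ
  label (i , j) = case-cmp j i (upper (j , i)) (t + m + i) (upper (i , j))

  Diagonal Lower Upper : Pred Point 0ℓ
  Diagonal = InT (m + m) ∩ λ p → proj₂ p ≡ proj₁ p
  Lower = InT (m + m) ∩ λ p → proj₂ p < proj₁ p
  Upper = InT (m + m) ∩ λ p → proj₁ p < proj₂ p

  upper-ranks : Ranking Upper (t + m) upper
  upper-ranks = ranking-cut-at-row f-ranks below-into above-into on-row
    where
    below-into : ∀ {i j} → Upper (i , j) → j < c → InT a (i , c ∸ j)
    below-into {i} {j} ((1≤i , _) , i<j) j<c = 1≤i , m<n⇒0<n∸m j<c ,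
      subst (i + (c ∸ j) ≤_) (+-comm 1 a) (≤-pred (reflected-sum i<j (<⇒≤ j<c)))
    above-into : ∀ {i j} → Upper (i , j) → c < j → InT a (i , j ∸ c)
    above-into {i} {j} ((1≤i , _ , i+j≤) , _) c<j = 1≤i , m<n⇒0<n∸m c<j ,
      shifted-sum (<⇒≤ c<j) (subst (i + j ≤_) (N+1≡c+a+1 a) i+j≤)
      where
      N+1≡c+a+1 : ∀ a → suc a + suc a + 1 ≡ suc (suc a) + (a + 1)
      N+1≡c+a+1 = solve-∀
    on-row : ∀ {i} → Upper (i , c) → 1 ≤ i × i ≤ m
    on-row ((1≤i , _) , i<c) = 1≤i , ≤-pred i<c

  lower-ranks : Ranking Lower (t + m) label
  lower-ranks = ranking-pullback swap (restrict (λ _ → _) swap-embedding)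
    (λ (inT , j<i) → InT-swap {m + m} inT , j<i) (λ (_ , j<i) → case-cmp-< j<i) upper-ranks

  diagonal-labels : FreshLabels Diagonal (t + m) m label
  diagonal-labels = record
    { index = proj₁
    ; label≡ = λ (_ , j≡i) → case-cmp-≡ j≡i
    ; index-positive = λ ((1≤i , _) , _) → 1≤i
    ; index-bounded = λ { {i , _} ((_ , _ , i+i≤) , refl) →
        half-≤ (subst (i + i ≤_) (+-comm (m + m) 1) i+i≤) }
    ; index-injective = λ (_ , j≡i) (_ , j'≡i') i≡i' →
        ×-≡,≡→≡ (i≡i' , trans j≡i (trans i≡i' (sym j'≡i')))
    }

  ranks : Ranking (InT (m + m)) (t + m + m) label
  ranks = ranking-separator (trichotomy-cover {InT (m + m)} proj₂ proj₁) diagonal-labels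
    (ranking-∪ (λ (_ , below) (_ , above) → diagonal-separates 0 below above)
      lower-ranks (ranking-cong (λ (_ , i<j) → case-cmp-> i<j) upper-ranks))

ranking-even-step : ∀ {a t f} → Ranking (InT a) t f →
  ∃[ f' ] Ranking (InT (suc a + suc a)) (t + suc a + suc a) f'
ranking-even-step f-ranks = EvenStep.label f-ranks , EvenStep.ranks f-ranks

module OddStep {m t : ℕ} {f : Point → ℕ} (1≤t : 1 ≤ t) (f-ranks : Ranking (InT m) t f) where

  c d : ℕ
  c = suc m
  d = suc c

  -- The corner (c, c) of Leftᵀ lies on the row y = c but has no neighbour in Leftᵀ off that
  -- row, so it need not be separated from anything and takes the label 1.
  corner-or-row : ℕ → ℕ
  corner-or-row x = case-cmp x c (t + x) 1 1

  -- left is written in transposed coordinates (x, y) = (j, i).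
  left right : Point → ℕ
  left = glue-at-row c (f ∘ swap) corner-or-row
  right = glue-at-row d f (t +_)

  label : Point → ℕ
  label (i , j) = case-cmp j (suc i) (left (j , i)) (t + m + i) (right (i , j))

  Step Left Right Leftᵀ : Pred Point 0ℓ
  Step = InT (suc m + m) ∩ λ p → proj₂ p ≡ suc (proj₁ p)
  Left = InT (suc m + m) ∩ λ p → proj₂ p < suc (proj₁ p)
  Right = InT (suc m + m) ∩ λ p → suc (proj₁ p) < proj₂ p
  Leftᵀ = InT (suc m + m) ∩ λ p → proj₁ p < suc (proj₂ p)

  N+1≡c+c : suc m + m + 1 ≡ c + c
  N+1≡c+c = identity m
    where
    identity : ∀ m → suc m + m + 1 ≡ suc m + suc m
    identity = solve-∀

  N+1≡d+m : suc m + m + 1 ≡ d + m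
  N+1≡d+m = +-comm (suc m + m) 1

  right-ranks : Ranking Right (t + m) right
  right-ranks = ranking-cut-at-row f-ranks below-into above-into on-row
    where
    below-into : ∀ {i j} → Right (i , j) → j < d → InT m (i , d ∸ j)
    below-into ((1≤i , _) , i+1<j) j<d = 1≤i , m<n⇒0<n∸m j<d ,
      ≤-trans (≤-pred (≤-pred (reflected-sum i+1<j (<⇒≤ j<d)))) (m≤m+n m 1)
    above-into : ∀ {i j} → Right (i , j) → d < j → InT m (i , j ∸ d)
    above-into {i} {j} ((1≤i , _ , i+j≤) , _) d<j = 1≤i , m<n⇒0<n∸m d<j ,
      ≤-trans (shifted-sum (<⇒≤ d<j) (subst (i + j ≤_) N+1≡d+m i+j≤)) (m≤m+n m 1)
    on-row : ∀ {i} → Right (i , d) → 1 ≤ i × i ≤ m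
    on-row {i} ((1≤i , _ , i+d≤) , _) =
      1≤i , +-cancelʳ-≤ d i m (subst (i + d ≤_) (trans N+1≡d+m (+-comm d m)) i+d≤)

  Row Off Corner : Pred Point 0ℓ
  Row = (Leftᵀ ∩ λ p → proj₂ p ≡ c) ∩ λ p → proj₁ p < c
  Off = (Leftᵀ ∩ λ p → proj₂ p < c) ∪ (Leftᵀ ∩ λ p → c < proj₂ p)
  Corner = ｛ c , c ｝

  off-left-of-corner : ∀ {x y} → Off (x , y) → x < c
  off-left-of-corner (inj₁ ((_ , x<y+1) , y<c)) = <-≤-trans x<y+1 y<c
  off-left-of-corner {x} {y} (inj₂ (((_ , _ , x+y≤) , _) , c<y)) =
    +-cancelʳ-< y x c (≤-<-trans (subst (x + y ≤_) N+1≡c+c x+y≤) (+-monoʳ-< c c<y))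

  leftᵀ-cover : Leftᵀ ⊆ Row ∪ (Off ∪ Corner)
  leftᵀ-cover {x , y} q@(_ , x<y+1) with <-cmp y c | <-cmp x c
  ... | tri< y<c _ _ | _ = inj₂ (inj₁ (inj₁ (q , y<c)))
  ... | tri> _ _ c<y | _ = inj₂ (inj₁ (inj₂ (q , c<y)))
  ... | tri≈ _ y≡c _ | tri< x<c _ _ = inj₁ ((q , y≡c) , x<c)
  ... | tri≈ _ y≡c _ | tri≈ _ x≡c _ = inj₂ (inj₂ (×-≡,≡→≡ (sym x≡c , sym y≡c)))
  ... | tri≈ _ refl _ | tri> _ _ c<x = ⊥-elim (<-irrefl refl (<-≤-trans c<x (≤-pred x<y+1)))

  row-labels : FreshLabels Row t m left
  row-labels = record
    { index = proj₁
    ; label≡ = λ ((_ , y≡c) , x<c) → trans (case-cmp-≡ y≡c) (case-cmp-< x<c)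
    ; index-positive = λ ((((1≤x , _) , _) , _) , _) → 1≤x
    ; index-bounded = λ (_ , x<c) → ≤-pred x<c
    ; index-injective = λ ((_ , y≡c) , _) ((_ , y'≡c) , _) x≡x' →
        ×-≡,≡→≡ (x≡x' , trans y≡c (sym y'≡c))
    }

  corner-ranks : Ranking Corner t left
  corner-ranks =
    ranking-singleton (≤-reflexive (sym corner-label)) (subst (_≤ t) (sym corner-label) 1≤t)
    where
    corner-label : left (c , c) ≡ 1
    corner-label = trans (case-cmp-≡ {x = c} {y = c} refl) (case-cmp-≡ {x = c} {y = c} refl)

  leftᵀ-ranks : Ranking Leftᵀ (t + m) left
  leftᵀ-ranks = ranking-separator leftᵀ-cover row-labels
    (ranking-∪ off-apart-from-corner
      (ranking-off-row f-swap-ranks below-into above-into corner-or-row) corner-ranks)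
    where
    f-swap-ranks : Ranking (InT m) t (f ∘ swap)
    f-swap-ranks = ranking-pullback swap (restrict (λ _ → _) swap-embedding)
      (InT-swap {m}) (λ _ → refl) f-ranks
    below-into : ∀ {x y} → Leftᵀ (x , y) → y < c → InT m (x , c ∸ y)
    below-into {x} {y} ((1≤x , _) , x<y+1) y<c = 1≤x , m<n⇒0<n∸m y<c ,
      subst (x + (c ∸ y) ≤_) (+-comm 1 m) (≤-pred (reflected-sum x<y+1 (s≤s (<⇒≤ y<c))))
    above-into : ∀ {x y} → Leftᵀ (x , y) → c < y → InT m (x , y ∸ c)
    above-into {x} {y} ((1≤x , _ , x+y≤) , _) c<y = 1≤x , m<n⇒0<n∸m c<y ,
      subst (x + (y ∸ c) ≤_) (+-comm 1 m) (shifted-sum (<⇒≤ c<y) (subst (x + y ≤_) N+1≡c+c x+y≤))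
    off-apart-from-corner : NonAdjacent Off Corner
    off-apart-from-corner {x , y} off refl adj with adj-shares-coordinate adj
    ... | inj₁ x≡c = <-irrefl x≡c (off-left-of-corner off)
    ... | inj₂ y≡c = Sum.[ <-irrefl y≡c ∘ proj₂ , <-irrefl (sym y≡c) ∘ proj₂ ] off

  left-ranks : Ranking Left (t + m) label
  left-ranks = ranking-pullback swap (restrict (λ _ → _) swap-embedding)
    (λ (inT , j<i+1) → InT-swap {suc m + m} inT , j<i+1) (λ (_ , j<i+1) → case-cmp-< j<i+1)
    leftᵀ-ranks

  step-labels : FreshLabels Step (t + m) m label
  step-labels = record
    { index = proj₁
    ; label≡ = λ (_ , j≡i+1) → case-cmp-≡ j≡i+1
    ; index-positive = λ ((1≤i , _) , _) → 1≤i
    ; index-bounded = λ { {i , _} ((_ , _ , i+i+1≤) , refl) →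
        half-≤ (≤-pred (subst₂ _≤_ (+-suc i i) (+-comm (suc m + m) 1) i+i+1≤)) }
    ; index-injective = λ (_ , j≡i+1) (_ , j'≡i'+1) i≡i' →
        ×-≡,≡→≡ (i≡i' , trans j≡i+1 (trans (cong suc i≡i') (sym j'≡i'+1)))
    }

  ranks : Ranking (InT (suc m + m)) (t + m + m) label
  ranks = ranking-separator (trichotomy-cover {InT (suc m + m)} proj₂ (suc ∘ proj₁)) step-labels
    (ranking-∪ (λ (_ , below) (_ , above) → diagonal-separates 1 below above)
      left-ranks (ranking-cong (λ (_ , i+1<j) → case-cmp-> i+1<j) right-ranks))

ranking-odd-step : ∀ {m t f} → 1 ≤ t → Ranking (InT m) t f →
  ∃[ f' ] Ranking (InT (suc m + m)) (t + m + m) f'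
ranking-odd-step 1≤t f-ranks = OddStep.label 1≤t f-ranks , OddStep.ranks 1≤t f-ranks

rank-bound : ℕ → ℕ
rank-bound n = 2 * n ∸ 2 * ⌊log₂ (n + 1) ⌋ + 1

⌊log₂[1+n]⌋≤n : ∀ n → ⌊log₂ (suc n) ⌋ ≤ n
⌊log₂[1+n]⌋≤n zero = z≤n
⌊log₂[1+n]⌋≤n (suc n) = begin
  ⌊log₂ (2 + n) ⌋      ≤⟨ ⌊log₂⌋-mono-≤ 2+n≤2*[1+n] ⟩
  ⌊log₂ (2 * suc n) ⌋  ≡⟨ ⌊log₂[2*b]⌋≡1+⌊log₂b⌋ (suc n) ⟩
  1 + ⌊log₂ (suc n) ⌋  ≤⟨ s≤s (⌊log₂[1+n]⌋≤n n) ⟩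
  suc n                ∎
  where
  open ≤-Reasoning
  2+n≤2*[1+n] : 2 + n ≤ 2 * suc n
  2+n≤2*[1+n] = subst (2 + n ≤_) (sym (*-suc 2 n)) (+-monoʳ-≤ 2 (m≤n*m n 2))

⌊log₂⌋-halve : ∀ n → ⌊log₂ (2 + n) ⌋ ≡ suc ⌊log₂ ⌊ 2 + n /2⌋ ⌋
⌊log₂⌋-halve n = begin
  ⌊log₂ (2 + n) ⌋            ≡⟨ sym (suc-pred _ {{>-nonZero log-positive}}) ⟩
  suc (⌊log₂ (2 + n) ⌋ ∸ 1)  ≡⟨ cong suc (sym (⌊log₂⌊n/2⌋⌋≡⌊log₂n⌋∸1 (2 + n))) ⟩
  suc ⌊log₂ ⌊ 2 + n /2⌋ ⌋    ∎
  where
  open ≡-Reasoning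
  log-positive : 0 < ⌊log₂ (2 + n) ⌋
  log-positive = ⌊log₂⌋-mono-≤ {2} {2 + n} (s≤s (s≤s z≤n))

rank-bound-step : ∀ k r → ⌊ suc (suc k + r) /2⌋ ≡ suc k →
  rank-bound (suc k + r) ≡ rank-bound k + r + r
rank-bound-step k r half = begin
  2 * (suc k + r) ∸ 2 * ⌊log₂ (suc k + r + 1) ⌋ + 1
    ≡⟨ cong (λ l → 2 * (suc k + r) ∸ 2 * l + 1) log-step ⟩
  2 * (suc k + r) ∸ 2 * suc ℓ + 1
    ≡⟨ cong₂ (λ x y → x ∸ y + 1) (double-suc k r) (*-suc 2 ℓ) ⟩
  (2 * k + 2 * r) ∸ 2 * ℓ + 1
    ≡⟨ cong (_+ 1) (+-∸-comm (2 * r) (*-monoʳ-≤ 2 ℓ≤k)) ⟩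
  (2 * k ∸ 2 * ℓ) + 2 * r + 1
    ≡⟨ regroup (2 * k ∸ 2 * ℓ) r ⟩
  rank-bound k + r + r
    ∎
  where
  open ≡-Reasoning
  ℓ : ℕ
  ℓ = ⌊log₂ (k + 1) ⌋
  ℓ≤k : ℓ ≤ k
  ℓ≤k = subst (λ n → ⌊log₂ n ⌋ ≤ k) (+-comm 1 k) (⌊log₂[1+n]⌋≤n k)
  log-step : ⌊log₂ (suc k + r + 1) ⌋ ≡ suc ℓ
  log-step = begin
    ⌊log₂ (suc k + r + 1) ⌋        ≡⟨ cong ⌊log₂_⌋ (+-comm (suc k + r) 1) ⟩
    ⌊log₂ (2 + (k + r)) ⌋          ≡⟨ ⌊log₂⌋-halve (k + r) ⟩
    suc ⌊log₂ ⌊ 2 + (k + r) /2⌋ ⌋  ≡⟨ cong (suc ∘ ⌊log₂_⌋) (trans half (+-comm 1 k)) ⟩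
    suc ℓ                          ∎
  double-suc : ∀ k r → 2 * (suc k + r) ≡ 2 + (2 * k + 2 * r)
  double-suc = solve-∀
  regroup : ∀ x r → x + 2 * r + 1 ≡ x + 1 + r + r
  regroup = solve-∀

data EvenOrOdd : ℕ → Set where
  even : ∀ m → EvenOrOdd (m + m)
  odd : ∀ m → EvenOrOdd (suc (m + m))

even-or-odd : ∀ n → EvenOrOdd n
even-or-odd zero = even zero
even-or-odd (suc n) with even-or-odd n
... | even m = odd m
... | odd m = subst EvenOrOdd (cong suc (+-suc m m)) (even (suc m))

RankingWithinBound : ℕ → Set
RankingWithinBound n = ∃[ f ] Ranking (InT n) (rank-bound n) f

within-bound : ∀ {n k} → rank-bound n ≡ k → ∃[ f ] Ranking (InT n) k f → RankingWithinBound n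
within-bound refl r = r

ranking : ∀ n → RankingWithinBound n
ranking = <-rec RankingWithinBound step
  where
  step : ∀ n → (∀ {k} → k < n → RankingWithinBound k) → RankingWithinBound n
  step n smaller with even-or-odd n
  ... | even zero = (λ _ → 1) , ranking-empty InT-zero-empty
  ... | even (suc a) =
    within-bound {suc a + suc a} (rank-bound-step a (suc a) (⌊1+n+n/2⌋≡n (suc a)))
    (ranking-even-step (proj₂ (smaller (s≤s (m≤m+n a (suc a))))))
  ... | odd m =
    within-bound {suc m + m} (rank-bound-step m m (cong suc (sym (n≡⌊n+n/2⌋ m))))
    (ranking-odd-step (m≤n+m 1 _) (proj₂ (smaller (s≤s (m≤m+n m m)))))

-- The bound holds for every n.
lemma9 : (n : ℕ) → 3 ≤ n → TriLe n (2 * n ∸ 2 * ⌊log₂ (n + 1) ⌋ + 1)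
lemma9 n _ = let f , f-ranks = ranking n in
  f , (λ _ p → positive f-ranks p , bounded f-ranks p) ,
  λ u v int u≢v fu≡fv (chain , inT , _) → higher-on-walks f-ranks u v int u≢v fu≡fv chain inT
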